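{- Let $f:\{0,1\}^n\to\{0,1\}$ with $f(0^n)=0$, and let $c_1,\dots,c_k$ be minimal $1$-certificates of $f$ such that (i) for each $i$, the total number of contradictions between $c_i$ and all the $c_j$, $j\ne i$, together is at most $2$, and (ii) for each position $p\in[n]$, exactly one of $c_1,\dots,c_k$ assigns the value $1$ to $p$. Then $s_0(f)\ge k$.
   Context: A $1$-certificate of $f$ is a partial assignment $c:S\to\{0,1\}$, $S\subseteq[n]$, such that $f(y)=1$ for every $y\in\{0,1\}^n$ with $y_p=c(p)$ for all $p\in S$; it is minimal if no restriction of $c$ to a proper subset of $S$ is a $1$-certificate. The number of contradictions between two partial assignments is the number of positions where one assigns $1$ and the other assigns $0$. $s_0(f)=\max_{x: f(x)=0}|\{i: f(x^{\{i\}})\ne f(x)\}|$, where $x^{\{i\}}$ is $x$ with bit $i$ flipped. -}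

module Defs where

open import Data.Nat using (ℕ; _+_; _≤_)
open import Data.Bool using (Bool; true; false; not; if_then_else_)
open import Data.Fin using (Fin)
open import Data.Fin.Properties using (_≟_)
open import Data.Maybe using (Maybe; just; nothing)
open import Data.List using (List; map; length; filter)
open import Data.Nat.ListAction using (sum)
open import Data.List using () renaming (allFin to finList)
open import Data.Product using (Σ; _×_; ∃; _,_)
open import Data.Sum using (_⊎_)
open import Relation.Binary.PropositionalEquality using (_≡_; _≢_)
open import Relation.Nullary using (¬_; Dec; yes; no)
open import Relation.Nullary.Decidable using (⌊_⌋)

-- Inputs x ∈ {0,1}^n, with false = 0, true = 1.
Input : ℕ → Set
Input n = Fin n → Bool

BoolFun : ℕ → Set
BoolFun n = Input n → Bool

zeros : ∀ {n} → Input n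
zeros _ = false

flip : ∀ {n} → Input n → Fin n → Input n
flip x i p with p ≟ i
... | yes _ = not (x p)
... | no  _ = x p

-- Partial assignment c : S → {0,1}, S ⊆ [n]; nothing = position not in S.
PartialAssignment : ℕ → Set
PartialAssignment n = Fin n → Maybe Bool

Consistent : ∀ {n} → PartialAssignment n → Input n → Set
Consistent {n} c y = ∀ (p : Fin n) (b : Bool) → c p ≡ just b → y p ≡ b

OneCertificate : ∀ {n} → BoolFun n → PartialAssignment n → Set
OneCertificate {n} f c = ∀ (y : Input n) → Consistent c y → f y ≡ true

IsRestriction : ∀ {n} → PartialAssignment n → PartialAssignment n → Set
IsRestriction {n} c' c = ∀ (p : Fin n) → (c' p ≡ nothing) ⊎ (c' p ≡ c p)

IsProperRestriction : ∀ {n} → PartialAssignment n → PartialAssignment n → Set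
IsProperRestriction {n} c' c = IsRestriction c' c × ∃ λ (p : Fin n) → c' p ≢ c p

MinimalOneCertificate : ∀ {n} → BoolFun n → PartialAssignment n → Set
MinimalOneCertificate {n} f c =
  OneCertificate f c ×
  (∀ (c' : PartialAssignment n) → IsProperRestriction c' c → ¬ OneCertificate f c')

contradictsAt : Maybe Bool → Maybe Bool → Bool
contradictsAt (just true)  (just false) = true
contradictsAt (just false) (just true)  = true
contradictsAt _            _            = false

contradictions : ∀ {n} → PartialAssignment n → PartialAssignment n → ℕ
contradictions {n} c d = length (filter (λ p → contradictsAt (c p) (d p) ≡? true) (finList n))
  where
  open import Data.Bool.Properties using () renaming (_≟_ to _≡?_)

sensitivityAt : ∀ {n} → BoolFun n → Input n → ℕ
sensitivityAt {n} f x =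
  length (filter (λ i → Relation.Nullary.¬? (f (flip x i) ≡? f x)) (finList n))
  where
  open import Data.Bool.Properties using () renaming (_≟_ to _≡?_)
  import Relation.Nullary

-- k ≤ s_0(f) = max_{x : f x = 0} sensitivityAt f x  (max over a finite set,
-- so this is equivalent to existence of a witness attaining ≥ k).
S0AtLeast : ∀ {n} → BoolFun n → ℕ → Set
S0AtLeast {n} f k = ∃ λ (x : Input n) → (f x ≡ false) × (k ≤ sensitivityAt f x)

totalContradictions : ∀ {n k} → (Fin k → PartialAssignment n) → Fin k → ℕ
totalContradictions {n} {k} c i =
  sum (map (λ j → contradictions (c i) (c j))
           (filter (λ j → Relation.Nullary.¬? (j ≟ i)) (finList k)))
  where import Relation.Nullary

-- Call a position an edge if exactly one certificate assigns 0 there; it joins that certificate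
-- to the unique certificate assigning 1 there. Each endpoint of an edge has a contradiction at it,
-- so by (i) the edges form a graph of maximum degree two, which can be oriented so that no
-- certificate is the head of two edges. The target input v is 1 where no certificate assigns 0,
-- 0 where several do, and on an edge the value opposing its head; then every certificate
-- disagrees with v in at most one position (several zeros at p exhaust the budget of the
-- 1-holder of p). Walking up from 0^n toward v while f stays 0 ends at an input y where every
-- further step toward v is sensitive. A certificate disagrees with y somewhere: either where
-- y ≠ v, a sensitive position, or only at its single disagreement with v, and flipping that bit
-- satisfies the certificate. Since y ≤ v, these positions are distinct for distinct certificates.

module Submission where

open import Data.Bool using (Bool; true; false; not; if_then_else_)
open import Data.Bool.Properties using (¬-not; not-¬) renaming (_≟_ to _≟ᵇ_)
open import Data.Fin using (Fin; zero; suc; _<_)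
open import Data.Fin.Properties using (_≟_; any?; pigeonhole; injective⇒≤)
open import Data.Fin.Subset using (Subset; _∈_; _∉_; _⊂_; _⊃_; _-_; Nonempty)
open import Data.Fin.Subset.Properties using (_∈?_; p─q⊆p; x∈p∧x≢y⇒x∈p-y; x∈p⇒p-x⊂p; nonempty?)
open import Data.Fin.Subset.Induction using (⊂-wellFounded; ⊃-wellFounded)
open import Data.List using (List; []; _∷_; length; concatMap; map; filter; allFin)
open import Data.List.Membership.Propositional using () renaming (_∈_ to _∈ₗ_)
open import Data.List.Membership.Setoid.Properties using (index-injective)
open import Data.List.Properties using (length-++; length-map; map-cong)
open import Data.List.Membership.Propositional.Properties using (∈-concat⁺′; ∈-map⁺; ∈-filter⁺; ∈-allFin)
open import Data.List.Relation.Unary.Any using (index)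
open import Data.Nat using (ℕ; _+_; _≤_; s≤s) renaming (_<_ to _ℕ<_)
open import Data.Nat.ListAction using (sum)
open import Data.Product using (∃; ∃₂; _×_; _,_; proj₁; proj₂)
open import Data.Sum using (_⊎_; inj₁; inj₂)
import Data.Sum as Sum
open import Data.Vec using (tabulate; _∷_; here; there)
open import Data.Vec.Functional using (updateAt)
open import Data.Vec.Functional.Properties using (updateAt-updates; updateAt-minimal)
open import Data.Vec.Properties using (lookup∘tabulate; []=⇒lookup; lookup⇒[]=)
open import Data.Empty using (⊥; ⊥-elim)
open import Data.Unit using (⊤; tt)
open import Data.Maybe using (just)
open import Data.Maybe.Properties using (≡-dec; just-injective)
open import Function using (_∘_; const)
open import Induction.WellFounded using (Acc; acc)
open import Relation.Binary using (DecidableEquality)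
open import Relation.Binary.PropositionalEquality using (_≡_; _≢_; refl; sym; trans; cong; subst; subst₂; setoid)
open import Relation.Nullary using (Dec; yes; no; does; ¬_; ¬?)
open import Relation.Nullary.Decidable using (_×-dec_; _⊎-dec_; decidable-stable; dec-true)
open import Relation.Unary using (Pred; Decidable)
open import Level using (0ℓ)

open import Defs

true≢false : true ≢ false
true≢false ()

module _ {A : Set} {xs : List A} where

  injective-members⇒≤length : ∀ {m} (g : Fin m → A) → (∀ i → g i ∈ₗ xs) →
    (∀ {i j} → g i ≡ g j → i ≡ j) → m ≤ length xs
  injective-members⇒≤length g g∈ g-inj =
    injective⇒≤ (g-inj ∘ index-injective (setoid A) (g∈ _) (g∈ _))

  pigeonhole-members : ∀ {m} → length xs ℕ< m → (g : Fin m → A) → (∀ i → g i ∈ₗ xs) →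
    ∃₂ λ i j → i < j × g i ≡ g j
  pigeonhole-members |xs|<m g g∈ with i , j , i<j , same-index ← pigeonhole |xs|<m (index ∘ g∈) =
    i , j , i<j , index-injective (setoid A) (g∈ i) (g∈ j) same-index

  two-of-three-coincide : length xs ≤ 2 → ∀ {a b d} → a ∈ₗ xs → b ∈ₗ xs → d ∈ₗ xs →
    a ≡ b ⊎ a ≡ d ⊎ b ≡ d
  two-of-three-coincide |xs|≤2 {a} {b} {d} a∈ b∈ d∈ =
    coincide (pigeonhole-members (s≤s |xs|≤2) elem member)
    where
    elem : Fin 3 → A
    elem zero             = a
    elem (suc zero)       = b
    elem (suc (suc zero)) = d

    member : ∀ i → elem i ∈ₗ xs
    member zero             = a∈
    member (suc zero)       = b∈
    member (suc (suc zero)) = d∈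

    coincide : (∃₂ λ i j → i < j × elem i ≡ elem j) → a ≡ b ⊎ a ≡ d ⊎ b ≡ d
    coincide (zero           , suc zero       , _ , a≡b) = inj₁ a≡b
    coincide (zero           , suc (suc zero) , _ , a≡d) = inj₂ (inj₁ a≡d)
    coincide (suc zero       , suc (suc zero) , _ , b≡d) = inj₂ (inj₂ b≡d)
    coincide (zero           , zero           , () , _)
    coincide (suc zero       , zero           , () , _)
    coincide (suc zero       , suc zero       , s≤s () , _)
    coincide (suc (suc zero) , zero           , () , _)
    coincide (suc (suc zero) , suc zero       , s≤s () , _)
    coincide (suc (suc zero) , suc (suc zero) , s≤s (s≤s ()) , _)

length-concatMap : ∀ {A B : Set} (g : A → List B) xs →
  length (concatMap g xs) ≡ sum (map (length ∘ g) xs)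
length-concatMap g []       = refl
length-concatMap g (x ∷ xs) =
  trans (length-++ (g x)) (cong (length (g x) +_) (length-concatMap g xs))

module _ {n} {P : Pred (Fin n) 0ℓ} where

  ⟦_⟧ : Decidable P → Subset n
  ⟦ P? ⟧ = tabulate (does ∘ P?)

  ∈⟦⟧⁺ : (P? : Decidable P) → ∀ {x} → P x → x ∈ ⟦ P? ⟧
  ∈⟦⟧⁺ P? {x} Px = lookup⇒[]= x ⟦ P? ⟧ (trans (lookup∘tabulate (does ∘ P?) x) (dec-true (P? x) Px))

  ∈⟦⟧⁻ : (P? : Decidable P) → ∀ {x} → x ∈ ⟦ P? ⟧ → P x
  ∈⟦⟧⁻ P? {x} x∈ with P? x | trans (sym (lookup∘tabulate (does ∘ P?) x)) ([]=⇒lookup x∈)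
  ... | yes Px | _  = Px
  ... | no _   | ()

x∉p-x : ∀ {n} (p : Subset n) x → x ∉ p - x
x∉p-x (_ ∷ p) zero    ()
x∉p-x (_ ∷ p) (suc x) (there x∈) = x∉p-x p x x∈

x∈p-y⇒x≢y : ∀ {n} {p : Subset n} {x y} → x ∈ p - y → x ≢ y
x∈p-y⇒x≢y {p = p} x∈ refl = x∉p-x p _ x∈

data Multiplicity {k} (P : Pred (Fin k) 0ℓ) : Set where
  none    : (∀ j → ¬ P j) → Multiplicity P
  unique  : ∀ j → P j → (∀ j′ → P j′ → j′ ≡ j) → Multiplicity P
  several : ∀ j₁ j₂ → j₁ ≢ j₂ → P j₁ → P j₂ → Multiplicity P

multiplicity : ∀ {k} {P : Pred (Fin k) 0ℓ} → Decidable P → Multiplicity P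
multiplicity P? with any? P?
... | no ∄ = none λ j Pj → ∄ (j , Pj)
... | yes (j , Pj) with any? (λ j′ → P? j′ ×-dec ¬? (j′ ≟ j))
...   | yes (j′ , Pj′ , j′≢j) = several j′ j j′≢j Pj′ Pj
...   | no ∄ = unique j Pj λ j′ Pj′ → decidable-stable (j′ ≟ j) λ j′≢j → ∄ (j′ , Pj′ , j′≢j)

module _ {k} {P : Pred (Fin k) 0ℓ} where

  IsUnique : Multiplicity P → Set
  IsUnique (unique _ _ _) = ⊤
  IsUnique _              = ⊥

  is-unique? : (μ : Multiplicity P) → Dec (IsUnique μ)
  is-unique? (none _)            = no λ ()
  is-unique? (unique _ _ _)      = yes tt
  is-unique? (several _ _ _ _ _) = no λ ()

  sole : Fin k → Multiplicity P → Fin k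
  sole _ (unique j _ _) = j
  sole d _              = d

  sole-unique : ∀ {d} (μ : Multiplicity P) → IsUnique μ → P (sole d μ) × (∀ j → P j → j ≡ sole d μ)
  sole-unique (unique j Pj only-j) _ = Pj , only-j

-- Orienting graphs of maximum degree two

module Orientation {V : Set} (_≟ᵥ_ : DecidableEquality V) {m : ℕ} (end₁ end₂ : Fin m → V) where

  end : Bool → Fin m → V
  end b e = if b then end₂ e else end₁ e

  Incident : V → Fin m → Set
  Incident u e = end₁ e ≡ u ⊎ end₂ e ≡ u

  end-incident : ∀ b e → Incident (end b e) e
  end-incident true  e = inj₂ refl
  end-incident false e = inj₁ refl

  Loopless : Subset m → Set
  Loopless E = ∀ {e} → e ∈ E → end₁ e ≢ end₂ e

  Degree≤1 : Subset m → V → Set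
  Degree≤1 E u = ∀ {d e} → d ∈ E → e ∈ E → Incident u d → Incident u e → d ≡ e

  Degree≤2 : Subset m → Set
  Degree≤2 E = ∀ {u c d e} → c ∈ E → d ∈ E → e ∈ E →
    Incident u c → Incident u d → Incident u e → c ≡ d ⊎ c ≡ e ⊎ d ≡ e

  InjectiveOn : Subset m → (Fin m → Bool) → Set
  InjectiveOn E σ = ∀ {d e} → d ∈ E → e ∈ E → end (σ d) d ≡ end (σ e) e → d ≡ e

  Avoids : Subset m → (Fin m → Bool) → V → Set
  Avoids E σ u = ∀ {e} → e ∈ E → end (σ e) e ≢ u

  end-avoiding : ∀ {E e} → Loopless E → e ∈ E → ∀ u → ∃ λ b → end b e ≢ u
  end-avoiding {e = e} loopless e∈E u with end₁ e ≟ᵥ u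
  ... | yes e₁≡u = true , λ e₂≡u → loopless e∈E (trans e₁≡u (sym e₂≡u))
  ... | no  e₁≢u = false , e₁≢u

  edge-at : ∀ {E u} → Degree≤1 E u → Nonempty E →
    ∃ λ e → e ∈ E × (∀ {d} → d ∈ E → Incident u d → d ≡ e)
  edge-at {E} {u} deg₁ (e₀ , e₀∈E)
    with any? (λ e → (e ∈? E) ×-dec ((end₁ e ≟ᵥ u) ⊎-dec (end₂ e ≟ᵥ u)))
  ... | yes (e , e∈E , u∼e) = e , e∈E , λ d∈E u∼d → deg₁ d∈E e∈E u∼d u∼e
  ... | no ∄ = e₀ , e₀∈E , λ d∈E u∼d → ⊥-elim (∄ (_ , d∈E , u∼d))

  degree≤1-after-removal : ∀ {E e u} → e ∈ E → Degree≤2 E → Incident u e → Degree≤1 (E - e) u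
  degree≤1-after-removal {E} {e} e∈E deg₂ u∼e d∈ d′∈ u∼d u∼d′
    with deg₂ (p─q⊆p E _ d∈) (p─q⊆p E _ d′∈) e∈E u∼d u∼d′ u∼e
  ... | inj₁ d≡d′        = d≡d′
  ... | inj₂ (inj₁ d≡e)  = ⊥-elim (x∈p-y⇒x≢y d∈ d≡e)
  ... | inj₂ (inj₂ d′≡e) = ⊥-elim (x∈p-y⇒x≢y d′∈ d′≡e)

  restrict-loopless : ∀ {E e} → Loopless E → Loopless (E - e)
  restrict-loopless {E} loopless = loopless ∘ p─q⊆p E _

  restrict-degree≤2 : ∀ {E e} → Degree≤2 E → Degree≤2 (E - e)
  restrict-degree≤2 {E} deg₂ c∈ d∈ e∈ = deg₂ (p─q⊆p E _ c∈) (p─q⊆p E _ d∈) (p─q⊆p E _ e∈)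

  module _ (σ : Fin m → Bool) (e : Fin m) (b : Bool) where

    end-updateAt-same : end (updateAt σ e (const b) e) e ≡ end b e
    end-updateAt-same = cong (λ s → end s e) (updateAt-updates e σ)

    end-updateAt-other : ∀ {d} → d ≢ e → end (updateAt σ e (const b) d) d ≡ end (σ d) d
    end-updateAt-other {d} d≢e = cong (λ s → end s d) (updateAt-minimal d e σ d≢e)

    updateAt-injectiveOn : ∀ {E} → InjectiveOn (E - e) σ → Avoids (E - e) σ (end b e) →
      InjectiveOn E (updateAt σ e (const b))
    updateAt-injectiveOn σ-inj σ-avoids {d} {d′} d∈E d′∈E same with d ≟ e | d′ ≟ e
    ... | yes refl | yes refl = refl
    ... | yes refl | no d′≢e  = ⊥-elim (σ-avoids (x∈p∧x≢y⇒x∈p-y d′∈E d′≢e)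
            (trans (sym (end-updateAt-other d′≢e)) (trans (sym same) end-updateAt-same)))
    ... | no d≢e   | yes refl = ⊥-elim (σ-avoids (x∈p∧x≢y⇒x∈p-y d∈E d≢e)
            (trans (sym (end-updateAt-other d≢e)) (trans same end-updateAt-same)))
    ... | no d≢e   | no d′≢e  = σ-inj (x∈p∧x≢y⇒x∈p-y d∈E d≢e) (x∈p∧x≢y⇒x∈p-y d′∈E d′≢e)
            (trans (sym (end-updateAt-other d≢e)) (trans same (end-updateAt-other d′≢e)))

  -- Point an edge at u (or any edge) away from u, and orient the rest avoiding its head,
  -- which has degree at most one once that edge is removed.
  orient-avoiding : ∀ {E} → Acc _⊂_ E → Loopless E → Degree≤2 E → ∀ u → Degree≤1 E u →
    ∃ λ σ → InjectiveOn E σ × Avoids E σ u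
  orient-avoiding {E} (acc smaller) loopless deg₂ u deg₁ with nonempty? E
  ... | no ∅ = const false , (λ d∈E → ⊥-elim (∅ (_ , d∈E))) , λ e∈E → ⊥-elim (∅ (_ , e∈E))
  ... | yes nonempty
    with e , e∈E , only-e-at-u ← edge-at deg₁ nonempty
    with b , e[b]≢u ← end-avoiding loopless e∈E u
    with σ , σ-inj , σ-avoids ← orient-avoiding (smaller (x∈p⇒p-x⊂p e∈E))
           (restrict-loopless loopless) (restrict-degree≤2 deg₂)
           (end b e) (degree≤1-after-removal e∈E deg₂ (end-incident b e))
    = updateAt σ e (const b) , updateAt-injectiveOn σ e b σ-inj σ-avoids , avoids
    where
    avoids : Avoids E (updateAt σ e (const b)) u
    avoids {d} d∈E at-u
      with refl ← only-e-at-u d∈E (subst (λ w → Incident w d) at-u (end-incident _ d))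
      = e[b]≢u (trans (sym (end-updateAt-same σ e b)) at-u)

  orientation : ∀ {E} → Loopless E → Degree≤2 E → ∃ λ σ → InjectiveOn E σ
  orientation {E} loopless deg₂ with nonempty? E
  ... | no ∅ = const false , λ d∈E → ⊥-elim (∅ (_ , d∈E))
  ... | yes (e , e∈E)
    with σ , σ-inj , σ-avoids ← orient-avoiding (⊂-wellFounded (E - e))
           (restrict-loopless loopless) (restrict-degree≤2 deg₂)
           (end₁ e) (degree≤1-after-removal e∈E deg₂ (inj₁ refl))
    = updateAt σ e (const false) , updateAt-injectiveOn σ e false σ-inj σ-avoids

-- Local search on the cube

flip-same : ∀ {n} (x : Input n) p → flip x p p ≡ not (x p)
flip-same x p with p ≟ p
... | yes _   = refl
... | no  p≢p = ⊥-elim (p≢p refl)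

flip-other : ∀ {n} (x : Input n) {p q} → q ≢ p → flip x p q ≡ x q
flip-other x {p} {q} q≢p with q ≟ p
... | yes q≡p = ⊥-elim (q≢p q≡p)
... | no  _   = refl

flip-toward : ∀ {n} (x v : Input n) {p} → x p ≢ v p → flip x p p ≡ v p
flip-toward x v {p} x≢v = trans (flip-same x p) (sym (¬-not (x≢v ∘ sym)))

module Walk {n} (f : BoolFun n) (v : Input n) where

  Blocked : Input n → Set
  Blocked y = ∀ p → y p ≢ v p → f (flip y p) ≡ true

  Between : Input n → Input n → Set
  Between x y = ∀ p → y p ≡ x p ⊎ y p ≡ v p

  agree? : (x : Input n) → Decidable (λ p → x p ≡ v p)
  agree? x p = x p ≟ᵇ v p

  agreements : Input n → Subset n
  agreements x = ⟦ agree? x ⟧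

  agreements-grow : ∀ {x p} → x p ≢ v p → agreements x ⊂ agreements (flip x p)
  agreements-grow {x} {p} x≢v =
      (λ q∈ → ∈⟦⟧⁺ (agree? (flip x p)) (agrees (∈⟦⟧⁻ (agree? x) q∈)))
    , p , ∈⟦⟧⁺ (agree? (flip x p)) (flip-toward x v x≢v) , x≢v ∘ ∈⟦⟧⁻ (agree? x)
    where
    agrees : ∀ {q} → x q ≡ v q → flip x p q ≡ v q
    agrees {q} x≡v = trans (flip-other x λ { refl → x≢v x≡v }) x≡v

  between-flip : ∀ {x p} → x p ≢ v p → Between x (flip x p)
  between-flip {x} {p} x≢v q with p ≟ q
  ... | yes refl = inj₂ (flip-toward x v x≢v)
  ... | no p≢q   = inj₁ (flip-other x (p≢q ∘ sym))

  between-trans : ∀ {x x′ y} → Between x x′ → Between x′ y → Between x y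
  between-trans x⇝x′ x′⇝y q with x′⇝y q | x⇝x′ q
  ... | inj₂ y≡v  | _          = inj₂ y≡v
  ... | inj₁ y≡x′ | inj₁ x′≡x  = inj₁ (trans y≡x′ x′≡x)
  ... | inj₁ y≡x′ | inj₂ x′≡v  = inj₂ (trans y≡x′ x′≡v)

  walk : ∀ x → Acc _⊃_ (agreements x) → f x ≡ false →
    ∃ λ y → f y ≡ false × Between x y × Blocked y
  walk x (acc closer) fx≡0 with any? (λ p → ¬? (agree? x p) ×-dec (f (flip x p) ≟ᵇ false))
  ... | no stuck = x , fx≡0 , (λ _ → inj₁ refl) , λ p x≢v → ¬-not λ f′≡0 → stuck (p , x≢v , f′≡0)
  ... | yes (p , x≢v , f′≡0)
    with y , fy≡0 , between , blocked ← walk (flip x p) (closer (agreements-grow x≢v)) f′≡0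
    = y , fy≡0 , between-trans (between-flip x≢v) between , blocked

  walk-toward : ∀ x → f x ≡ false → ∃ λ y → f y ≡ false × Between x y × Blocked y
  walk-toward x = walk x (⊃-wellFounded _)

module _ {n} {c : PartialAssignment n} where

  disagree? : ∀ (y : Input n) p → Dec (c p ≡ just (not (y p)))
  disagree? y p = ≡-dec _≟ᵇ_ (c p) (just (not (y p)))

  agree-or-disagree : ∀ {y : Input n} {q b} → c q ≡ just b → y q ≡ b ⊎ c q ≡ just (not (y q))
  agree-or-disagree {y} {q} {b} cq≡b with y q ≟ᵇ b
  ... | yes y≡b = inj₁ y≡b
  ... | no  y≢b = inj₂ (trans cq≡b (cong just (¬-not (y≢b ∘ sym))))

  -- Either c disagrees with y where y ≠ v, which is sensitive as y is blocked, or all its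
  -- disagreements with y are disagreements with v, so there is only one and flipping it
  -- satisfies c.
  certificate-sensitive : ∀ {f : BoolFun n} {v y : Input n} →
    OneCertificate f c → f y ≡ false → Walk.Blocked f v y →
    (∀ {p q} → c p ≡ just (not (v p)) → c q ≡ just (not (v q)) → p ≡ q) →
    ∃ λ p → c p ≡ just (not (y p)) × f (flip y p) ≡ true
  certificate-sensitive {f} {v} {y} certificate fy≡0 blocked at-most-one-against-v
    with any? (λ p → disagree? y p ×-dec ¬? (y p ≟ᵇ v p))
  ... | yes (p , c≠y , y≢v) = p , c≠y , blocked p y≢v
  ... | no off-v-agrees with any? (disagree? y)
  ...   | no agrees = ⊥-elim (true≢false (trans (sym (certificate y consistent)) fy≡0))
    where
    consistent : Consistent c y
    consistent q b cq≡b with agree-or-disagree {y = y} cq≡b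
    ... | inj₁ y≡b = y≡b
    ... | inj₂ c≠y = ⊥-elim (agrees (q , c≠y))
  ...   | yes (p , c≠y) = p , c≠y , certificate (flip y p) consistent
    where
    against-v : ∀ {q} → c q ≡ just (not (y q)) → c q ≡ just (not (v q))
    against-v {q} c≠y′ = subst (λ b → c q ≡ just (not b))
      (decidable-stable (y q ≟ᵇ v q) λ y≢v → off-v-agrees (q , c≠y′ , y≢v)) c≠y′

    consistent : Consistent c (flip y p)
    consistent q b cq≡b with p ≟ q
    ... | yes refl = trans (flip-same y p) (just-injective (trans (sym c≠y) cq≡b))
    ... | no p≢q with agree-or-disagree {y = y} cq≡b
    ...   | inj₁ y≡b  = trans (flip-other y (p≢q ∘ sym)) y≡b
    ...   | inj₂ c≠y′ = ⊥-elim (p≢q (at-most-one-against-v (against-v c≠y) (against-v c≠y′)))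

module _ {n k} (c : Fin k → PartialAssignment n) (i : Fin k) where

  Conflict : Fin k × Fin n → Set
  Conflict (j , p) = j ≢ i × contradictsAt (c i p) (c j p) ≡ true

  contradiction-positions : Fin k → List (Fin n)
  contradiction-positions j = filter (λ p → contradictsAt (c i p) (c j p) ≟ᵇ true) (allFin n)

  conflicts-with : Fin k → List (Fin k × Fin n)
  conflicts-with j = map (j ,_) (contradiction-positions j)

  others : List (Fin k)
  others = filter (λ j → ¬? (j ≟ i)) (allFin k)

  conflicts : List (Fin k × Fin n)
  conflicts = concatMap conflicts-with others

  length-conflicts : length conflicts ≡ totalContradictions c i
  length-conflicts = trans (length-concatMap conflicts-with others)
    (cong sum (map-cong (λ j → length-map (j ,_) (contradiction-positions j)) others))

  ∈-conflicts : ∀ {a} → Conflict a → a ∈ₗ conflicts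
  ∈-conflicts {j , p} (j≢i , contradicts) =
    ∈-concat⁺′ (∈-map⁺ (j ,_) (∈-filter⁺ _ (∈-allFin p) contradicts))
               (∈-map⁺ conflicts-with (∈-filter⁺ _ (∈-allFin j) j≢i))

  two-of-three-conflicts : totalContradictions c i ≤ 2 → ∀ {a b d} →
    Conflict a → Conflict b → Conflict d → a ≡ b ⊎ a ≡ d ⊎ b ≡ d
  two-of-three-conflicts ≤2 κa κb κd =
    two-of-three-coincide (subst (_≤ 2) (sym length-conflicts) ≤2)
      (∈-conflicts κa) (∈-conflicts κb) (∈-conflicts κd)

contradictsAt-opposite : ∀ b → contradictsAt (just b) (just (not b)) ≡ true
contradictsAt-opposite true  = refl
contradictsAt-opposite false = refl

module Certificates {n k} (f : BoolFun n) (f0≡0 : f zeros ≡ false) (c : Fin k → PartialAssignment n)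
  (certificate : ∀ i → OneCertificate f (c i))
  (few-conflicts : ∀ i → totalContradictions c i ≤ 2)
  (unique-one : ∀ p → ∃ λ i → c i p ≡ just true × (∀ j → c j p ≡ just true → j ≡ i))
  where

  one-holder : Fin n → Fin k
  one-holder p = proj₁ (unique-one p)

  one-holder-assigns : ∀ {p} → c (one-holder p) p ≡ just true
  one-holder-assigns {p} = proj₁ (proj₂ (unique-one p))

  one-holder-unique : ∀ {p j} → c j p ≡ just true → j ≡ one-holder p
  one-holder-unique {p} = proj₂ (proj₂ (unique-one p)) _

  opposite-conflict : ∀ {i j p b} → c i p ≡ just b → c j p ≡ just (not b) → Conflict c i (j , p)
  opposite-conflict {b = b} ci≡b cj≡¬b =
      (λ { refl → not-¬ refl (just-injective (trans (sym ci≡b) cj≡¬b)) })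
    , subst₂ (λ x y → contradictsAt x y ≡ true) (sym ci≡b) (sym cj≡¬b) (contradictsAt-opposite b)

  zero-holders : ∀ p → Multiplicity (λ j → c j p ≡ just false)
  zero-holders p = multiplicity (λ j → ≡-dec _≟ᵇ_ (c j p) (just false))

  edge? : Decidable (λ p → IsUnique (zero-holders p))
  edge? p = is-unique? (zero-holders p)

  edges : Subset n
  edges = ⟦ edge? ⟧

  -- Off the edges the value is junk; only its values on edges are ever used.
  zero-holder : Fin n → Fin k
  zero-holder p = sole (one-holder p) (zero-holders p)

  zero-holder-unique : ∀ {p} → p ∈ edges →
    c (zero-holder p) p ≡ just false × (∀ j → c j p ≡ just false → j ≡ zero-holder p)
  zero-holder-unique {p} p∈E = sole-unique (zero-holders p) (∈⟦⟧⁻ edge? p∈E)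

  open Orientation _≟_ one-holder zero-holder

  incident-conflict : ∀ {i p} → p ∈ edges → Incident i p → ∃ λ j → Conflict c i (j , p)
  incident-conflict p∈E (inj₁ refl) =
    _ , opposite-conflict one-holder-assigns (proj₁ (zero-holder-unique p∈E))
  incident-conflict p∈E (inj₂ refl) =
    _ , opposite-conflict (proj₁ (zero-holder-unique p∈E)) one-holder-assigns

  loopless : Loopless edges
  loopless {p} p∈E same = proj₁ (opposite-conflict one-holder-assigns
    (subst (λ j → c j p ≡ just false) (sym same) (proj₁ (zero-holder-unique p∈E)))) refl

  degree≤2 : Degree≤2 edges
  degree≤2 {u} c∈E d∈E e∈E u∼c u∼d u∼e
    with _ , κc ← incident-conflict c∈E u∼c
    with _ , κd ← incident-conflict d∈E u∼d
    with _ , κe ← incident-conflict e∈E u∼e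
    = Sum.map (cong proj₂) (Sum.map (cong proj₂) (cong proj₂))
        (two-of-three-conflicts c u (few-conflicts u) κc κd κe)

  -- Opaque, since unfolding the orientation makes checking the case analyses on target very slow.
  opaque
    σ : Fin n → Bool
    σ = proj₁ (orientation loopless degree≤2)

    σ-injective : InjectiveOn edges σ
    σ-injective = proj₂ (orientation loopless degree≤2)

  target-value : ∀ {P : Pred (Fin k) 0ℓ} → Bool → Multiplicity P → Bool
  target-value _ (none _)            = true
  target-value b (unique _ _ _)      = b
  target-value _ (several _ _ _ _ _) = false

  target : Input n
  target p = target-value (σ p) (zero-holders p)

  Against : Fin k → Fin n → Set
  Against i p = c i p ≡ just (not (target p))

  DoubleConflict : Fin k → Fin n → Set
  DoubleConflict i p = ∃₂ λ j₁ j₂ → j₁ ≢ j₂ × Conflict c i (j₁ , p) × Conflict c i (j₂ , p)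

  against-cases : ∀ {i p} → Against i p → (p ∈ edges × end (σ p) p ≡ i) ⊎ DoubleConflict i p
  against-cases {i} {p} = cases (zero-holders p) refl
    where
    cases : ∀ μ → zero-holders p ≡ μ → c i p ≡ just (not (target-value (σ p) μ)) →
      (p ∈ edges × end (σ p) p ≡ i) ⊎ DoubleConflict i p
    cases (none no-zero) _ zero-i = ⊥-elim (no-zero i zero-i)
    cases (several j₁ j₂ j₁≢j₂ zero₁ zero₂) _ one-i =
      inj₂ (j₁ , j₂ , j₁≢j₂ , opposite-conflict one-i zero₁ , opposite-conflict one-i zero₂)
    cases (unique j _ only-j) μ≡ against =
      inj₁ (∈⟦⟧⁺ edge? (subst IsUnique (sym μ≡) tt) , chosen (σ p) against)
      where
      chosen : ∀ b → c i p ≡ just (not b) → end b p ≡ i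
      chosen true  zero-i = sym (trans (only-j i zero-i) (cong (sole (one-holder p)) (sym μ≡)))
      chosen false one-i  = sym (one-holder-unique one-i)

  against-conflict : ∀ {i p} → Against i p → ∃ λ j → Conflict c i (j , p)
  against-conflict {p = p} against with against-cases against
  ... | inj₁ (p∈E , chosen) =
    incident-conflict p∈E (subst (λ w → Incident w p) chosen (end-incident (σ p) p))
  ... | inj₂ (j₁ , _ , _ , κ₁ , _) = j₁ , κ₁

  double-conflict-unique : ∀ {i p q} → DoubleConflict i p → Against i q → p ≡ q
  double-conflict-unique {i} (j₁ , j₂ , j₁≢j₂ , κ₁ , κ₂) against
    with _ , κ ← against-conflict against
    with two-of-three-conflicts c i (few-conflicts i) κ₁ κ₂ κ
  ... | inj₁ same          = ⊥-elim (j₁≢j₂ (cong proj₁ same))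
  ... | inj₂ (inj₁ same)   = cong proj₂ same
  ... | inj₂ (inj₂ same)   = cong proj₂ same

  against-unique : ∀ {i p q} → Against i p → Against i q → p ≡ q
  against-unique against-p against-q with against-cases against-p | against-cases against-q
  ... | inj₁ (p∈E , chosen-p) | inj₁ (q∈E , chosen-q) =
    σ-injective p∈E q∈E (trans chosen-p (sym chosen-q))
  ... | inj₂ double | _          = double-conflict-unique double against-q
  ... | inj₁ _      | inj₂ double = sym (double-conflict-unique double against-p)

  target-true⇒one-zero : ∀ {p i j} → target p ≡ true →
    c i p ≡ just false → c j p ≡ just false → i ≡ j
  target-true⇒one-zero {p} {i} {j} = cases (zero-holders p)
    where
    cases : ∀ μ → target-value (σ p) μ ≡ true → c i p ≡ just false → c j p ≡ just false → i ≡ j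
    cases (none no-zero)      _  zero-i _      = ⊥-elim (no-zero i zero-i)
    cases (unique _ _ only)   _  zero-i zero-j = trans (only i zero-i) (sym (only j zero-j))
    cases (several _ _ _ _ _) ()

  open Walk f target

  walked : ∃ λ y → f y ≡ false × Between zeros y × Blocked y
  walked = walk-toward zeros f0≡0

  y : Input n
  y = proj₁ walked

  fy≡0 : f y ≡ false
  fy≡0 = proj₁ (proj₂ walked)

  y-between : Between zeros y
  y-between = proj₁ (proj₂ (proj₂ walked))

  y-blocked : Blocked y
  y-blocked = proj₂ (proj₂ (proj₂ walked))

  sensitive : ∀ i → ∃ λ p → c i p ≡ just (not (y p)) × f (flip y p) ≡ true
  sensitive i = certificate-sensitive (certificate i) fy≡0 y-blocked against-unique

  position : Fin k → Fin n
  position i = proj₁ (sensitive i)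

  disagreement-determines-certificate : ∀ {i j p} →
    c i p ≡ just (not (y p)) → c j p ≡ just (not (y p)) → i ≡ j
  disagreement-determines-certificate {i} {j} {p} with y p | y-between p
  ... | false | _        = λ one-i one-j →
    trans (one-holder-unique one-i) (sym (one-holder-unique one-j))
  ... | true  | inj₁ ()
  ... | true  | inj₂ y≡v = target-true⇒one-zero (sym y≡v)

  position-injective : ∀ {i j} → position i ≡ position j → i ≡ j
  position-injective {i} {j} same =
    disagreement-determines-certificate (proj₁ (proj₂ (sensitive i)))
      (subst (λ p → c j p ≡ just (not (y p))) (sym same) (proj₁ (proj₂ (sensitive j))))

  position-sensitive : ∀ i → f (flip y (position i)) ≢ f y
  position-sensitive i flipped≡ =
    true≢false (trans (sym (proj₂ (proj₂ (sensitive i)))) (trans flipped≡ fy≡0))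

lemma3 : ∀ (n : ℕ) (f : BoolFun n) → f zeros ≡ false →
    ∀ (k : ℕ) (c : Fin k → PartialAssignment n) →
    (∀ (i : Fin k) → MinimalOneCertificate f (c i)) →
    (∀ (i : Fin k) → totalContradictions c i ≤ 2) →
    (∀ (p : Fin n) → ∃ λ (i : Fin k) → (c i p ≡ just true) ×
    (∀ (j : Fin k) → c j p ≡ just true → j ≡ i)) →
    S0AtLeast f k
lemma3 n f f0≡0 k c minimal few-conflicts unique-one =
  y , fy≡0 , injective-members⇒≤length position
    (λ i → ∈-filter⁺ _ (∈-allFin (position i)) (position-sensitive i)) position-injective
  where open Certificates f f0≡0 c (proj₁ ∘ minimal) few-conflicts unique-one
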